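{- Let $G$ be a finite simple graph and let $R$ and $C$ be subsets of $V(G)$ with $|R|=|C|$. Then $(R,C)$ is a persistent triangle of $G$ if and only if $V(G)\setminus C$ is a zero forcing set for $G$ from which $R$ can be the set of vertices that force.
   Context: A zero-nonzero pattern is a matrix with entries in $\{0,*\}$; a square pattern is a triangle if some permutation of its rows followed by some independent permutation of its columns yields a lower-triangular pattern with only $*$ entries on the diagonal. $\mathcal{S}_{\mathrm{znz}}(G)$ is the set of the $2^{|G|}$ symmetric $V(G)\times V(G)$ zero-nonzero patterns whose off-diagonal $(i,j)$ entry is $*$ exactly when $\{i,j\}\in E(G)$, with arbitrary diagonal. $(R,C)$ with $|R|=|C|$ is a persistent triangle of $G$ if $\mathcal A[R,C]$ (rows $R$, columns $C$) is a triangle for every $\mathcal A\in \mathcal{S}_{\mathrm{znz}}(G)$. Zero forcing rule: a filled vertex $v$ forces (fills) an unfilled vertex $u$ if $u$ is the only unfilled neighbor of $v$; each vertex forces at most once. A forcing sequence from $F$ is a sequence of forces each allowed when starting with $F$ filled after the previous forces; it is complete if no further force is possible afterwards. $F$ is a zero forcing set if repeated forcing fills all of $V(G)$. "$F$ is a zero forcing set from which $R$ can be the set of vertices that force" means $F$ is a zero forcing set and some complete forcing sequence from $F$ has exactly $R$ as its set of forcing vertices. -}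

module Defs where

open import Data.Nat using (ℕ)
open import Data.Bool using (Bool; true; false; if_then_else_)
open import Data.Fin using (Fin; _≟_; _<_)
open import Data.Fin.Subset using (Subset; _∈_; _∉_)
open import Data.List using (List; []; _∷_; _++_; map)
import Data.List.Membership.Propositional as LM
open import Data.Product using (Σ; ∃; _×_; _,_; proj₁; proj₂)
open import Data.Sum using (_⊎_)
open import Data.Unit using (⊤)
open import Relation.Nullary using (¬_; does)
open import Relation.Binary.PropositionalEquality using (_≡_; _≢_)
open import Function.Definitions using (Injective)

record Graph (n : ℕ) : Set where
  field
    adj   : Fin n → Fin n → Bool
    sym   : ∀ i j → adj i j ≡ adj j i
    loopless : ∀ i → adj i i ≡ false
open Graph public

-- Zero-nonzero patterns: true = *, false = 0.
Pattern : ℕ → Set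
Pattern n = Fin n → Fin n → Bool

patternOf : ∀ {n} → Graph n → (Fin n → Bool) → Pattern n
patternOf G d i j = if does (i ≟ j) then d i else adj G i j

-- A[R,C] is a triangle: there are orderings ρ of R and γ of C
-- (i.e. a row permutation and an independent column permutation of A[R,C])
-- giving a lower-triangular pattern with * on the diagonal.
IsTriangle : ∀ {n} → Pattern n → Subset n → Subset n → Set
IsTriangle {n} A R C =
  Σ ℕ λ k → Σ (Fin k → Fin n) λ ρ → Σ (Fin k → Fin n) λ γ →
    Injective _≡_ _≡_ ρ × Injective _≡_ _≡_ γ ×
    (∀ i → ρ i ∈ R) × (∀ v → v ∈ R → ∃ λ i → ρ i ≡ v) ×
    (∀ i → γ i ∈ C) × (∀ v → v ∈ C → ∃ λ i → γ i ≡ v) ×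
    (∀ i → A (ρ i) (γ i) ≡ true) ×
    (∀ i j → i < j → A (ρ i) (γ j) ≡ false)

PersistentTriangle : ∀ {n} → Graph n → Subset n → Subset n → Set
PersistentTriangle G R C = ∀ (d : Fin _ → Bool) → IsTriangle (patternOf G d) R C

-- Zero forcing.  A force is a pair (v , u): v forces u.
Force : ℕ → Set
Force n = Fin n × Fin n

Filled : ∀ {n} → Subset n → List (Force n) → Fin n → Set
Filled F done w = w ∈ F ⊎ w LM.∈ map proj₂ done

CanForce : ∀ {n} → Graph n → Subset n → List (Force n) → Fin n → Fin n → Set
CanForce G F done v u =
  Filled F done v × ¬ Filled F done u × adj G v u ≡ true ×
  (∀ w → adj G v w ≡ true → w ≢ u → Filled F done w) ×
  ¬ (v LM.∈ map proj₁ done)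

ValidFrom : ∀ {n} → Graph n → Subset n → List (Force n) → List (Force n) → Set
ValidFrom G F done [] = ⊤
ValidFrom G F done ((v , u) ∷ rest) =
  CanForce G F done v u × ValidFrom G F (done ++ ((v , u) ∷ [])) rest

ForcingSequence : ∀ {n} → Graph n → Subset n → List (Force n) → Set
ForcingSequence G F s = ValidFrom G F [] s

Complete : ∀ {n} → Graph n → Subset n → List (Force n) → Set
Complete G F s = ∀ v u → ¬ CanForce G F s v u

ZeroForcingSet : ∀ {n} → Graph n → Subset n → Set
ZeroForcingSet G F =
  Σ (List (Force _)) λ s → ForcingSequence G F s × (∀ w → Filled F s w)

{-# OPTIONS --safe #-}
-- Both directions peel off one force at a time.  If V ∖ C forces
-- r₁ → c₁, …, rₖ → cₖ in this order and fills everything, then rows r₁ … rₖ and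
-- columns c₁ … cₖ form a triangle for every diagonal: when rᵢ forces cᵢ, the
-- vertices cᵢ₊₁, …, cₖ are still unfilled, so none of them is rᵢ or a neighbour
-- of rᵢ.  Conversely, give the diagonal a star exactly at the vertices with a
-- neighbour in C.  The first row r of a triangle for that pattern has a single
-- star among the columns C, at c say; this rules out r ∈ C, so c is the only
-- neighbour of r in C and r can force c.  Deleting row r and column c leaves a
-- triangle for every diagonal, and induction on ∣ C ∣ finishes.  Finally, a
-- complete forcing sequence from a zero forcing set fills every vertex, because
-- a force that becomes available stays available until its target is filled.
module Submission where

open import Defs
open import Data.Nat using (ℕ)
open import Data.Fin using (Fin)
open import Data.Fin.Subset using (Subset; _∈_; ∣_∣; ∁)
open import Data.List using (List; map)
open import Data.List.Membership.Propositional using () renaming (_∈_ to _∈ₗ_)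
open import Data.Product using (Σ; _×_; proj₁)
open import Function.Bundles using (_⇔_)
open import Relation.Binary.PropositionalEquality using (_≡_)

open import Data.Bool using (Bool; true; false)
open import Data.Bool.Properties using (¬-not) renaming (_≟_ to _≟ᵇ_)
open import Data.Empty using (⊥-elim)
open import Data.Fin using (zero; suc; _<_; _≟_; punchIn; punchOut)
open import Data.Fin.Properties
  using (any?; ≤∧≢⇒<; <⇒≢; punchIn-injective; punchIn-mono-≤; punchInᵢ≢i; punchIn-punchOut)
open import Data.Fin.Subset using (_∉_; _─_; _-_; ⁅_⁆; Nonempty; Empty; outside)
open import Data.Fin.Subset.Properties
  using (_∈?_; nonempty?; x∈⁅x⁆; x∈∁p⇒x∉p; x∉p⇒x∈∁p; p─q⊆p; x∈p∧x≢y⇒x∈p-y; x∈p⇒∣p-x∣<∣p∣)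
open import Data.List using ([]; _∷_; _++_; [_]; _∷ʳ_)
open import Data.List.Membership.Propositional using () renaming (_∉_ to _∉ₗ_)
import Data.List.Membership.DecPropositional as DecMembership
open import Data.List.Properties using (++-assoc; ++-identityʳ)
open import Data.List.Relation.Binary.Subset.Propositional.Properties using (map⁺; xs⊆xs++ys)
open import Data.List.Relation.Unary.Any using (here; there)
open import Data.Nat using (suc; s≤s; z≤n) renaming (_<_ to _<ℕ_)
open import Data.Nat.Properties using (<⇒≤; n<1+n; <-≤-trans; ≤-pred)
open import Data.Product using (∃; ∃₂; _,_; proj₂; uncurry)
open import Data.Sum using (_⊎_; inj₁; inj₂)
import Data.Sum as Sum
open import Data.Unit using (tt)
import Data.Vec.Base as Vec
open import Data.Vec.Functional using () renaming (_∷_ to _◂_)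
open import Function.Base using (_∘_)
open import Function.Bundles using (mk⇔; Equivalence)
open import Function.Definitions using (Injective)
open import Function.Properties.Equivalence using () renaming (refl to ⇔-refl)
open import Relation.Binary.PropositionalEquality using (_≢_; refl; trans; cong; subst)
import Relation.Binary.PropositionalEquality as ≡
open import Relation.Nullary using (¬_; Dec; yes; no; does; contradiction)
open import Relation.Nullary.Decidable using (dec-true; dec-false; _×-dec_; _⊎-dec_)

private
  variable
    n k : ℕ
    A : Pattern n
    F P R C : Subset n
    r c v u w x : Fin n
    done rest : List (Force n)

true≢false : true ≢ false
true≢false ()

x∈p─q⇒x∉q : ∀ (p q : Subset n) → x ∈ p ─ q → x ∉ q
x∈p─q⇒x∉q (_ Vec.∷ p) (outside Vec.∷ q) Vec.here              ()
x∈p─q⇒x∉q (_ Vec.∷ p) (_       Vec.∷ q) (Vec.there x∈p─q) (Vec.there x∈q) =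
  x∈p─q⇒x∉q p q x∈p─q x∈q

x∈p-y⇒x≢y : ∀ {p : Subset n} {x y} → x ∈ p - y → x ≢ y
x∈p-y⇒x≢y {p = p} {y = y} x∈p-y refl = x∈p─q⇒x∉q p ⁅ y ⁆ x∈p-y (x∈⁅x⁆ y)

x∈p-y⇒x∈p : ∀ {p : Subset n} {x y} → x ∈ p - y → x ∈ p
x∈p-y⇒x∈p {p = p} {y = y} = p─q⊆p p ⁅ y ⁆

x∉p∧y∈p⇒x≢y : ∀ {p : Subset n} {x y} → x ∉ p → y ∈ p → x ≢ y
x∉p∧y∈p⇒x≢y x∉p y∈p refl = x∉p y∈p

∈-map-∷ʳ⁺ : ∀ {X Y : Set} (f : X → Y) xs {x} → f x ∈ₗ map f (xs ∷ʳ x)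
∈-map-∷ʳ⁺ f []       = here refl
∈-map-∷ʳ⁺ f (_ ∷ xs) = there (∈-map-∷ʳ⁺ f xs)

∈-map-∷ʳ⁻ : ∀ {X Y : Set} (f : X → Y) xs {x y} →
            y ∈ₗ map f (xs ∷ʳ x) → y ∈ₗ map f xs ⊎ y ≡ f x
∈-map-∷ʳ⁻ f []       (here y≡fx) = inj₂ y≡fx
∈-map-∷ʳ⁻ f (_ ∷ xs) (here y≡fz) = inj₁ (here y≡fz)
∈-map-∷ʳ⁻ f (_ ∷ xs) (there y∈)  = Sum.map₁ there (∈-map-∷ʳ⁻ f xs y∈)

infix 4 _≐_
_≐_ : Subset n → List (Fin n) → Set
P ≐ xs = ∀ v → v ∈ P ⇔ v ∈ₗ xs

≐[]⇒Empty : P ≐ [] → Empty P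
≐[]⇒Empty P≐[] (v , v∈P) with Equivalence.to (P≐[] v) v∈P
... | ()

≐-∷⁺ : ∀ {xs} → P - v ≐ xs → v ∈ P → P ≐ v ∷ xs
≐-∷⁺ {P = P} {v = v} {xs} P-v≐xs v∈P w = mk⇔ to from
  where
  to : w ∈ P → w ∈ₗ v ∷ xs
  to w∈P with w ≟ v
  ... | yes w≡v = here w≡v
  ... | no  w≢v = there (Equivalence.to (P-v≐xs w) (x∈p∧x≢y⇒x∈p-y w∈P w≢v))
  from : w ∈ₗ v ∷ xs → w ∈ P
  from (here refl)  = v∈P
  from (there w∈xs) = x∈p-y⇒x∈p (Equivalence.from (P-v≐xs w) w∈xs)

≐-∷⁻ : ∀ {xs} → P ≐ v ∷ xs → v ∉ₗ xs → P - v ≐ xs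
≐-∷⁻ {P = P} {v = v} {xs} P≐v∷xs v∉xs w = mk⇔ to from
  where
  to : w ∈ P - v → w ∈ₗ xs
  to w∈P-v with Equivalence.to (P≐v∷xs w) (x∈p-y⇒x∈p w∈P-v)
  ... | here w≡v   = contradiction w≡v (x∈p-y⇒x≢y w∈P-v)
  ... | there w∈xs = w∈xs
  from : w ∈ₗ xs → w ∈ P - v
  from w∈xs =
    x∈p∧x≢y⇒x∈p-y (Equivalence.from (P≐v∷xs w) (there w∈xs)) λ { refl → v∉xs w∈xs }

module _ {f : Fin (suc k) → Fin n} {P : Subset n} {i : Fin (suc k)} {x : Fin n}
         (fi≡x : f i ≡ x) where

  punchIn-∈ : Injective _≡_ _≡_ f → (∀ j → f j ∈ P) → ∀ j → f (punchIn i j) ∈ P - x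
  punchIn-∈ f-inj f∈P j =
    x∈p∧x≢y⇒x∈p-y (f∈P _) (λ e → punchInᵢ≢i i j (f-inj (trans e (≡.sym fi≡x))))

  punchIn-covers : (∀ v → v ∈ P → ∃ λ j → f j ≡ v) →
                   ∀ v → v ∈ P - x → ∃ λ j → f (punchIn i j) ≡ v
  punchIn-covers P⊆f v v∈P-x with P⊆f v (x∈p-y⇒x∈p v∈P-x)
  ... | j , fj≡v = punchOut i≢j , trans (cong f (punchIn-punchOut i≢j)) fj≡v
    where
    i≢j : i ≢ j
    i≢j refl = x∈p-y⇒x≢y v∈P-x (trans (≡.sym fj≡v) fi≡x)

punchIn-mono-< : ∀ (i : Fin (suc k)) {j j′} → j < j′ → punchIn i j < punchIn i j′
punchIn-mono-< i {j} {j′} j<j′ =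
  ≤∧≢⇒< (punchIn-mono-≤ i j j′ (<⇒≤ j<j′)) (<⇒≢ j<j′ ∘ punchIn-injective i j j′)

∷-injective : ∀ {f : Fin k → Fin n} → (∀ j → f j ≢ x) → Injective _≡_ _≡_ f →
              Injective _≡_ _≡_ (x ◂ f)
∷-injective x∉f f-inj {zero}  {zero}  _ = refl
∷-injective x∉f f-inj {zero}  {suc j} e = contradiction (≡.sym e) (x∉f j)
∷-injective x∉f f-inj {suc i} {zero}  e = contradiction e (x∉f i)
∷-injective x∉f f-inj {suc i} {suc j} e = cong suc (f-inj e)

module _ {f : Fin k → Fin n} {P : Subset n} {x : Fin n} (x∈P : x ∈ P) where

  ∷-∈ : (∀ j → f j ∈ P - x) → ∀ j → (x ◂ f) j ∈ P
  ∷-∈ f∈P-x zero    = x∈P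
  ∷-∈ f∈P-x (suc j) = x∈p-y⇒x∈p (f∈P-x j)

  ∷-covers : (∀ v → v ∈ P - x → ∃ λ j → f j ≡ v) → ∀ v → v ∈ P → ∃ λ j → (x ◂ f) j ≡ v
  ∷-covers P-x⊆f v v∈P with v ≟ x
  ... | yes refl = zero , refl
  ... | no  v≢x  = let j , fj≡v = P-x⊆f v (x∈p∧x≢y⇒x∈p-y v∈P v≢x) in suc j , fj≡v

OnlyStar : Pattern n → Fin n → Subset n → Fin n → Set
OnlyStar A r C c = ∀ w → w ∈ C → A r w ≡ true → w ≡ c

empty-triangle : Empty R → Empty C → IsTriangle A R C
empty-triangle R≡∅ C≡∅ =
  0 , (λ ()) , (λ ()) , (λ { {()} }) , (λ { {()} }) ,
  (λ ()) , (λ v v∈R → contradiction (v , v∈R) R≡∅) ,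
  (λ ()) , (λ v v∈C → contradiction (v , v∈C) C≡∅) ,
  (λ ()) , (λ ())

Empty-columns⇒Empty-rows : IsTriangle A R C → Empty C → Empty R
Empty-columns⇒Empty-rows (_ , _ , γ , _ , _ , _ , R⊆ρ , γ∈C , _) C≡∅ (v , v∈R) =
  C≡∅ (γ i , γ∈C i)
  where
  i : Fin _
  i = proj₁ (R⊆ρ v v∈R)

triangle-pivot : IsTriangle A R C → Nonempty C →
                 ∃₂ λ r c → r ∈ R × c ∈ C × A r c ≡ true × OnlyStar A r C c
triangle-pivot (_ , _ , _ , _ , _ , _ , _ , _ , C⊆γ , _) (c₀ , c₀∈C) with C⊆γ c₀ c₀∈C
triangle-pivot {A = A} {C = C} (suc k , ρ , γ , _ , _ , ρ∈R , _ , γ∈C , C⊆γ , diag , lower) _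
  | _ = ρ zero , γ zero , ρ∈R zero , γ∈C zero , diag zero , only
  where
  only : OnlyStar A (ρ zero) C (γ zero)
  only w w∈C star with C⊆γ w w∈C
  ... | zero  , refl = refl
  ... | suc j , refl =
    contradiction (trans (≡.sym star) (lower zero (suc j) (s≤s z≤n))) true≢false

triangle-delete : IsTriangle A R C → r ∈ R → OnlyStar A r C c →
                  IsTriangle A (R - r) (C - c)
triangle-delete (_ , _ , _ , _ , _ , _ , R⊆ρ , _) r∈R _ with R⊆ρ _ r∈R
triangle-delete {A = A} {c = c}
  (suc k , ρ , γ , ρ-inj , γ-inj , ρ∈R , R⊆ρ , γ∈C , C⊆γ , diag , lower) r∈R only
  | i , ρi≡r =
  k , ρ ∘ punchIn i , γ ∘ punchIn i ,
  punchIn-injective i _ _ ∘ ρ-inj , punchIn-injective i _ _ ∘ γ-inj ,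
  punchIn-∈ ρi≡r ρ-inj ρ∈R , punchIn-covers ρi≡r R⊆ρ ,
  punchIn-∈ γi≡c γ-inj γ∈C , punchIn-covers γi≡c C⊆γ ,
  diag ∘ punchIn i , λ j j′ j<j′ → lower _ _ (punchIn-mono-< i j<j′)
  where
  γi≡c : γ i ≡ c
  γi≡c = only (γ i) (γ∈C i) (subst (λ x → A x (γ i) ≡ true) ρi≡r (diag i))

triangle-extend : IsTriangle A (R - r) (C - c) → r ∈ R → c ∈ C → A r c ≡ true →
                  OnlyStar A r C c → IsTriangle A R C
triangle-extend {A = A} {r = r} {c = c}
  (k , ρ , γ , ρ-inj , γ-inj , ρ∈R-r , R-r⊆ρ , γ∈C-c , C-c⊆γ , diag , lower)
  r∈R c∈C rc-star only =
  suc k , r ◂ ρ , c ◂ γ ,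
  ∷-injective (x∈p-y⇒x≢y ∘ ρ∈R-r) ρ-inj , ∷-injective (x∈p-y⇒x≢y ∘ γ∈C-c) γ-inj ,
  ∷-∈ r∈R ρ∈R-r , ∷-covers r∈R R-r⊆ρ , ∷-∈ c∈C γ∈C-c , ∷-covers c∈C C-c⊆γ ,
  diag′ , lower′
  where
  diag′ : ∀ i → A ((r ◂ ρ) i) ((c ◂ γ) i) ≡ true
  diag′ zero    = rc-star
  diag′ (suc i) = diag i
  lower′ : ∀ i j → i < j → A ((r ◂ ρ) i) ((c ◂ γ) j) ≡ false
  lower′ zero    (suc j) _         =
    ¬-not λ star → x∈p-y⇒x≢y (γ∈C-c j) (only (γ j) (x∈p-y⇒x∈p (γ∈C-c j)) star)
  lower′ (suc i) (suc j) (s≤s i<j) = lower i j i<j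

patternOf-diagonal : ∀ (G : Graph n) d v → patternOf G d v v ≡ d v
patternOf-diagonal G d v with v ≟ v
... | yes _   = refl
... | no  v≢v = contradiction refl v≢v

patternOf-offDiagonal : ∀ (G : Graph n) d {v w} → v ≢ w → patternOf G d v w ≡ adj G v w
patternOf-offDiagonal G d {v} {w} v≢w with v ≟ w
... | yes v≡w = contradiction v≡w v≢w
... | no  _   = refl

patternOf-star : ∀ (G : Graph n) d {v w} → patternOf G d v w ≡ true →
                 (v ≡ w × d v ≡ true) ⊎ adj G v w ≡ true
patternOf-star G d {v} {w} star with v ≟ w
... | yes v≡w = inj₁ (v≡w , star)
... | no  _   = inj₂ star

patternOf-onlyStar⁺ : ∀ (G : Graph n) d → v ∉ C →
                      OnlyStar (adj G) v C u → OnlyStar (patternOf G d) v C u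
patternOf-onlyStar⁺ G d v∉C only w w∈C star =
  only w w∈C (trans (≡.sym (patternOf-offDiagonal G d (x∉p∧y∈p⇒x≢y v∉C w∈C))) star)

patternOf-onlyStar⁻ : ∀ (G : Graph n) d → v ∉ C →
                      OnlyStar (patternOf G d) v C u → OnlyStar (adj G) v C u
patternOf-onlyStar⁻ G d v∉C only w w∈C edge =
  only w w∈C (trans (patternOf-offDiagonal G d (x∉p∧y∈p⇒x≢y v∉C w∈C)) edge)

SoleNeighbour : Graph n → Subset n → Fin n → Fin n → Set
SoleNeighbour G C v u = v ∉ C × u ∈ C × adj G v u ≡ true × OnlyStar (adj G) v C u

HasNeighbourIn : Graph n → Subset n → Fin n → Set
HasNeighbourIn G C v = ∃ λ w → adj G v w ≡ true × w ∈ C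

hasNeighbourIn? : ∀ (G : Graph n) C v → Dec (HasNeighbourIn G C v)
hasNeighbourIn? G C v = any? λ w → (adj G v w ≟ᵇ true) ×-dec (w ∈? C)

neighbourDiagonal : Graph n → Subset n → Fin n → Bool
neighbourDiagonal G C v = does (hasNeighbourIn? G C v)

-- If the pivot row r lay in C, its star in column c ∈ C would make the diagonal
-- entry (r , r) a star, so c = r; but that entry is a star only when r has a
-- neighbour in C, which would be a second star of row r among the columns C.
neighbourDiagonal-pivot : ∀ (G : Graph n) →
  IsTriangle (patternOf G (neighbourDiagonal G C)) R C → Nonempty C →
  ∃₂ λ r c → r ∈ R × SoleNeighbour G C r c
neighbourDiagonal-pivot {C = C} G T C≢∅ with triangle-pivot T C≢∅
... | r , c , r∈R , c∈C , rc-star , only =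
  r , c , r∈R , r∉C , c∈C ,
  trans (≡.sym (patternOf-offDiagonal G d (x∉p∧y∈p⇒x≢y r∉C c∈C))) rc-star ,
  patternOf-onlyStar⁻ G d r∉C only
  where
  d : Fin _ → Bool
  d = neighbourDiagonal G C

  no-neighbour : r ∈ C → ¬ HasNeighbourIn G C r
  no-neighbour r∈C N@(w , rw-edge , w∈C) = r≢w (trans r≡c (≡.sym w≡c))
    where
    r≡c : r ≡ c
    r≡c = only r r∈C (trans (patternOf-diagonal G d r) (dec-true (hasNeighbourIn? G C r) N))
    r≢w : r ≢ w
    r≢w refl = contradiction (trans (≡.sym rw-edge) (loopless G r)) true≢false
    w≡c : w ≡ c
    w≡c = only w w∈C (trans (patternOf-offDiagonal G d r≢w) rw-edge)

  some-neighbour : ¬ ¬ HasNeighbourIn G C r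
  some-neighbour ¬N with patternOf-star G d rc-star
  ... | inj₁ (refl , dr≡true) =
    contradiction (trans (≡.sym dr≡true) (dec-false (hasNeighbourIn? G C r) ¬N)) true≢false
  ... | inj₂ rc-edge = ¬N (c , rc-edge , c∈C)

  r∉C : r ∉ C
  r∉C r∈C = some-neighbour (no-neighbour r∈C)

forcers : List (Force n) → List (Fin n)
forcers = map proj₁

AllFilled : Subset n → List (Force n) → Set
AllFilled F s = ∀ w → Filled F s w

filled? : ∀ (F : Subset n) done w → Dec (Filled F done w)
filled? F done w = (w ∈? F) ⊎-dec DecMembership._∈?_ _≟_ w (map proj₂ done)

filled-++⁺ˡ : ∀ rest → Filled F done w → Filled F (done ++ rest) w
filled-++⁺ˡ rest (inj₁ w∈F)    = inj₁ w∈F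
filled-++⁺ˡ {done = done} rest (inj₂ w∈done) =
  inj₂ (map⁺ proj₂ (xs⊆xs++ys done rest) w∈done)

filled-≡ : done ≡ rest → Filled F done w ⇔ Filled F rest w
filled-≡ refl = ⇔-refl

filled-++[] : Filled F (done ++ []) w ⇔ Filled F done w
filled-++[] {done = done} = filled-≡ (++-identityʳ done)

filled-∷ʳ-++ : ∀ {force : Force n} →
               Filled F (done ∷ʳ force ++ rest) w ⇔ Filled F (done ++ force ∷ rest) w
filled-∷ʳ-++ {done = done} {rest = rest} {force = force} = filled-≡ (++-assoc done [ force ] rest)

filled-∷ʳ⁺ : Filled F (done ∷ʳ (v , u)) u
filled-∷ʳ⁺ {done = done} = inj₂ (∈-map-∷ʳ⁺ proj₂ done)

filled-∷ʳ⁻ : Filled F (done ∷ʳ (v , u)) w → Filled F done w ⊎ w ≡ u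
filled-∷ʳ⁻ (inj₁ w∈F) = inj₁ (inj₁ w∈F)
filled-∷ʳ⁻ {done = done} (inj₂ w∈done∷ʳ) =
  Sum.map₁ inj₂ (∈-map-∷ʳ⁻ proj₂ done w∈done∷ʳ)

record UnfilledSet (F : Subset n) (done : List (Force n)) (C : Subset n) : Set where
  field
    filled⇒∉ : ∀ {w} → Filled F done w → w ∉ C
    ∉⇒filled : ∀ {w} → w ∉ C → Filled F done w

  unfilled⇒∈ : ∀ {w} → ¬ Filled F done w → w ∈ C
  unfilled⇒∈ {w} w-unfilled with w ∈? C
  ... | yes w∈C = w∈C
  ... | no  w∉C = contradiction (∉⇒filled w∉C) w-unfilled

open UnfilledSet

unfilledSet-∁ : UnfilledSet (∁ C) [] C
unfilledSet-∁ .filled⇒∉ (inj₁ w∈∁C) = x∈∁p⇒x∉p w∈∁C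
unfilledSet-∁ .∉⇒filled w∉C         = inj₁ (x∉p⇒x∈∁p w∉C)

unfilledSet-∷ʳ : UnfilledSet F done C → UnfilledSet F (done ∷ʳ (v , u)) (C - u)
unfilledSet-∷ʳ U .filled⇒∉ w-filled w∈C-u with filled-∷ʳ⁻ w-filled
... | inj₁ w-filled-before = filled⇒∉ U w-filled-before (x∈p-y⇒x∈p w∈C-u)
... | inj₂ w≡u             = x∈p-y⇒x≢y w∈C-u w≡u
unfilledSet-∷ʳ {u = u} U .∉⇒filled {w} w∉C-u with w ≟ u
... | yes refl = filled-∷ʳ⁺
... | no  w≢u  = filled-++⁺ˡ _ (∉⇒filled U λ w∈C → w∉C-u (x∈p∧x≢y⇒x∈p-y w∈C w≢u))

module _ (G : Graph n) {F : Subset n} {done : List (Force n)} {C : Subset n}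
         (U : UnfilledSet F done C) {v u : Fin n} where

  canForce⇒soleNeighbour : CanForce G F done v u → SoleNeighbour G C v u
  canForce⇒soleNeighbour (v-filled , u-unfilled , vu-edge , others-filled , _) =
    filled⇒∉ U v-filled , unfilled⇒∈ U u-unfilled , vu-edge , only
    where
    only : OnlyStar (adj G) v C u
    only w w∈C vw-edge with w ≟ u
    ... | yes w≡u = w≡u
    ... | no  w≢u = contradiction w∈C (filled⇒∉ U (others-filled w vw-edge w≢u))

  soleNeighbour⇒canForce : v ∉ₗ forcers done → SoleNeighbour G C v u → CanForce G F done v u
  soleNeighbour⇒canForce v-fresh (v∉C , u∈C , vu-edge , only) =
    ∉⇒filled U v∉C , (λ u-filled → filled⇒∉ U u-filled u∈C) , vu-edge ,
    (λ w vw-edge w≢u → ∉⇒filled U λ w∈C → w≢u (only w w∈C vw-edge)) , v-fresh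

allFilled⇒complete : ∀ (G : Graph n) {s} → AllFilled F s → Complete G F s
allFilled⇒complete G all-filled v u (_ , u-unfilled , _) = u-unfilled (all-filled u)

validFrom-forcers-fresh : ∀ (G : Graph n) rest → ValidFrom G F done rest →
                          v ∈ₗ forcers rest → v ∉ₗ forcers done
validFrom-forcers-fresh G (_ ∷ rest) ((_ , _ , _ , _ , v-fresh) , _) (here refl) = v-fresh
validFrom-forcers-fresh {done = done} G (_ ∷ rest) (_ , valid) (there v∈rest) v∈done =
  validFrom-forcers-fresh G rest valid v∈rest (map⁺ proj₁ (xs⊆xs++ys done _) v∈done)

validFrom-forcer-neighbours-filled : ∀ (G : Graph n) rest → ValidFrom G F done rest →
  v ∈ₗ forcers rest → adj G v w ≡ true → Filled F (done ++ rest) w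
validFrom-forcer-neighbours-filled {w = w} G ((_ , u) ∷ rest)
  ((_ , _ , _ , others-filled , _) , _) (here refl) vw-edge with w ≟ u
... | yes refl = Equivalence.to filled-∷ʳ-++ (filled-++⁺ˡ rest filled-∷ʳ⁺)
... | no  w≢u  = filled-++⁺ˡ (_ ∷ rest) (others-filled w vw-edge w≢u)
validFrom-forcer-neighbours-filled G (_ ∷ rest) (_ , valid) (there v∈rest) vw-edge =
  Equivalence.to filled-∷ʳ-++ (validFrom-forcer-neighbours-filled G rest valid v∈rest vw-edge)

module _ (G : Graph n) (F : Subset n) {s : List (Force n)}
         (valid : ForcingSequence G F s) (complete : Complete G F s) where

  validFrom-filled-⊆-complete : ∀ {done} rest → ValidFrom G F done rest →
    (∀ {w} → Filled F done w → Filled F s w) →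
    ∀ {w} → Filled F (done ++ rest) w → Filled F s w
  validFrom-filled-⊆-complete [] _ done⊆s = done⊆s ∘ Equivalence.to filled-++[]
  validFrom-filled-⊆-complete {done} ((v , u) ∷ rest)
    ((v-filled , _ , vu-edge , others-filled , _) , valid′) done⊆s =
    validFrom-filled-⊆-complete rest valid′ done∷ʳ⊆s ∘ Equivalence.from filled-∷ʳ-++
    where
    u-filled : Filled F s u
    u-filled with filled? F s u
    ... | yes u-filled  = u-filled
    ... | no u-unfilled =
      ⊥-elim (complete v u
        (done⊆s v-filled , u-unfilled , vu-edge ,
         (λ w vw-edge w≢u → done⊆s (others-filled w vw-edge w≢u)) ,
         u-unfilled ∘ λ v∈s → validFrom-forcer-neighbours-filled G s valid v∈s vu-edge))
    done∷ʳ⊆s : ∀ {w} → Filled F (done ∷ʳ (v , u)) w → Filled F s w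
    done∷ʳ⊆s w-filled with filled-∷ʳ⁻ w-filled
    ... | inj₁ w-filled-before = done⊆s w-filled-before
    ... | inj₂ refl            = u-filled

  zeroForcingSet⇒allFilled : ZeroForcingSet G F → AllFilled F s
  zeroForcingSet⇒allFilled (s₀ , valid₀ , all-filled₀) w =
    validFrom-filled-⊆-complete s₀ valid₀ (λ { (inj₁ w∈F) → inj₁ w∈F }) (all-filled₀ w)

module _ (G : Graph n) (F : Subset n) where

  forcingSequence⇒persistentTriangle : ∀ {done R C} rest → ValidFrom G F done rest →
    AllFilled F (done ++ rest) → UnfilledSet F done C → R ≐ forcers rest →
    PersistentTriangle G R C
  forcingSequence⇒persistentTriangle [] _ all-filled U R≐[] d =
    empty-triangle {A = patternOf G d} (≐[]⇒Empty R≐[]) λ (w , w∈C) →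
      filled⇒∉ U (Equivalence.to filled-++[] (all-filled w)) w∈C
  forcingSequence⇒persistentTriangle {done} {R} {C} ((v , u) ∷ rest) (v→u , valid)
    all-filled U R≐ d with canForce⇒soleNeighbour G U v→u
  ... | v∉C , u∈C , vu-edge , only =
    triangle-extend
      (forcingSequence⇒persistentTriangle rest valid
         (Equivalence.from filled-∷ʳ-++ ∘ all-filled) (unfilledSet-∷ʳ U) (≐-∷⁻ R≐ v∉rest) d)
      v∈R u∈C vu-star (patternOf-onlyStar⁺ G d v∉C only)
    where
    v∈R : v ∈ R
    v∈R = Equivalence.from (R≐ v) (here refl)
    v∉rest : v ∉ₗ forcers rest
    v∉rest v∈rest = validFrom-forcers-fresh G rest valid v∈rest (∈-map-∷ʳ⁺ proj₁ done)
    vu-star : patternOf G d v u ≡ true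
    vu-star = trans (patternOf-offDiagonal G d (x∉p∧y∈p⇒x≢y v∉C u∈C)) vu-edge

  persistentTriangle⇒forcingSequence : ∀ {done R C} → UnfilledSet F done C →
    (∀ {v} → v ∈ₗ forcers done → v ∉ R) → PersistentTriangle G R C →
    ∃ λ rest → ValidFrom G F done rest × R ≐ forcers rest × AllFilled F (done ++ rest)
  persistentTriangle⇒forcingSequence {C = C} = go (suc ∣ C ∣) (n<1+n ∣ C ∣)
    where
    go : ∀ m {done R C} → ∣ C ∣ <ℕ m → UnfilledSet F done C →
      (∀ {v} → v ∈ₗ forcers done → v ∉ R) → PersistentTriangle G R C →
      ∃ λ rest → ValidFrom G F done rest × R ≐ forcers rest × AllFilled F (done ++ rest)
    go (suc m) {done} {R} {C} ∣C∣<m U done∩R≡∅ T with nonempty? C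
    ... | no C≡∅ =
      [] , tt , (λ v → mk⇔ (λ v∈R → contradiction (v , v∈R) R≡∅) λ ()) ,
      λ w → Equivalence.from filled-++[] (∉⇒filled U λ w∈C → C≡∅ (w , w∈C))
      where
      R≡∅ : Empty R
      R≡∅ = Empty-columns⇒Empty-rows {A = patternOf G (λ _ → false)} (T (λ _ → false)) C≡∅
    ... | yes C≢∅ with neighbourDiagonal-pivot {R = R} G (T (neighbourDiagonal G C)) C≢∅
    ... | r , c , r∈R , sole@(r∉C , c∈C , _ , only)
      with go m (<-≤-trans (x∈p⇒∣p-x∣<∣p∣ c∈C) (≤-pred ∣C∣<m)) (unfilledSet-∷ʳ U) fresh
              (λ d → triangle-delete (T d) r∈R (patternOf-onlyStar⁺ G d r∉C only))
      where
      fresh : ∀ {v} → v ∈ₗ forcers (done ∷ʳ (r , c)) → v ∉ R - r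
      fresh {v} v∈ with ∈-map-∷ʳ⁻ proj₁ done v∈
      ... | inj₁ v∈done = done∩R≡∅ v∈done ∘ x∈p-y⇒x∈p
      ... | inj₂ refl   = λ r∈R-r → x∈p-y⇒x≢y r∈R-r refl
    ... | rest , valid , R-r≐rest , all-filled =
      (r , c) ∷ rest ,
      (soleNeighbour⇒canForce G U (λ r∈done → done∩R≡∅ r∈done r∈R) sole , valid) ,
      ≐-∷⁺ R-r≐rest r∈R ,
      Equivalence.to filled-∷ʳ-++ ∘ all-filled

ForcerSet : Graph n → Subset n → Subset n → Set
ForcerSet {n} G F R = Σ (List (Force n)) λ s →
  ForcingSequence G F s × Complete G F s × (∀ v → (v ∈ R) ⇔ (v ∈ₗ map proj₁ s))

persistentTriangle⇒forcing : ∀ (G : Graph n) →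
  PersistentTriangle G R C → ZeroForcingSet G (∁ C) × ForcerSet G (∁ C) R
persistentTriangle⇒forcing {C = C} G T =
  let s , valid , R≐s , all-filled =
        persistentTriangle⇒forcingSequence G (∁ C) unfilledSet-∁ (λ ()) T
  in (s , valid , all-filled) , s , valid , allFilled⇒complete G all-filled , R≐s

forcing⇒persistentTriangle : ∀ (G : Graph n) →
  ZeroForcingSet G (∁ C) → ForcerSet G (∁ C) R → PersistentTriangle G R C
forcing⇒persistentTriangle {C = C} G zfs (s , valid , complete , R≐s) =
  forcingSequence⇒persistentTriangle G (∁ C) s valid
    (zeroForcingSet⇒allFilled G (∁ C) valid complete zfs) unfilledSet-∁ R≐s

theorem2p7 : ∀ (n : ℕ) (G : Graph n) (R C : Subset n) → ∣ R ∣ ≡ ∣ C ∣ →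
    PersistentTriangle G R C ⇔
      (ZeroForcingSet G (∁ C) ×
        Σ (List (Force n)) (λ s → ForcingSequence G (∁ C) s × Complete G (∁ C) s ×
          (∀ v → (v ∈ R) ⇔ (v ∈ₗ map proj₁ s))))
theorem2p7 n G R C _ =
  mk⇔ (persistentTriangle⇒forcing G) (uncurry (forcing⇒persistentTriangle G))
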